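{- Let $(T,\mu,\eta)$ be a monad on a category $\mathcal{V}$ and $l:TT\Rightarrow TT$ a self-distributive law of $T$ over itself. Let $T_T$ be the Kleisli lifting of $T$ along $T$ (via $l$), a monad on the Kleisli category $\mathcal{V}_T$. Then the family $l_T$ whose component at $A$ is the morphism $\eta_{TTA}\circ l_A:TTA\to TTTA$ in $\mathcal{V}$, viewed as a morphism $T_TT_TA\to T_TT_TA$ in $\mathcal{V}_T$, is a self-distributive law of the monad $T_T$ over itself.
   Context: A distributive law of a monad $T$ over itself is a natural transformation $l:TT\Rightarrow TT$ with $\mu T\circ Tl\circ lT=l\circ T\mu$, $l\circ T\eta=\eta T$, $T\mu\circ lT\circ Tl=l\circ\mu T$, $l\circ\eta T=T\eta$. It is self-distributive if moreover it satisfies the Yang–Baxter equation $Tl\circ lT\circ Tl=lT\circ Tl\circ lT$. The Kleisli category $\mathcal{V}_T$ has morphisms $A\to B$ the morphisms $A\to TB$ of $\mathcal{V}$. The Kleisli lifting $T_T:\mathcal{V}_T\to\mathcal{V}_T$ sends $A$ to $TA$ and $f:A\to TB$ to $l_B\circ Tf:TA\to TTB$; it is a monad on $\mathcal{V}_T$ with unit component $\eta_{TA}\circ\eta_A:A\to TTA$ and multiplication component $\eta_{TA}\circ\mu_A:TTA\to TTA$ (as Kleisli morphisms $A\to T_TA$ and $T_TT_TA\to T_TA$). Self-distributive laws for a monad on $\mathcal{V}_T$ are defined by the same equations, computed in $\mathcal{V}_T$. -}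

module Defs where

open import Level using (Level; _⊔_; suc)
open import Relation.Binary using (Rel; IsEquivalence)

-- The "raw" part (objects, homs, equality, composition, identities) is
-- separated so that derived structures (Kleisli category, Kleisli lifting)
-- can be defined as plain data without proof obligations.

record RawCategory (o ℓ e : Level) : Set (suc (o ⊔ ℓ ⊔ e)) where
  infixr 9 _∘_
  infix 4 _≈_
  field
    Obj : Set o
    Hom : Obj → Obj → Set ℓ
    _≈_ : ∀ {A B} → Rel (Hom A B) e
    id  : ∀ {A} → Hom A A
    _∘_ : ∀ {A B C} → Hom B C → Hom A B → Hom A C

record Category (o ℓ e : Level) : Set (suc (o ⊔ ℓ ⊔ e)) where
  field
    raw : RawCategory o ℓ e
  open RawCategory raw public
  field
    equiv     : ∀ {A B} → IsEquivalence (_≈_ {A} {B})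
    assoc     : ∀ {A B C D} {f : Hom A B} {g : Hom B C} {h : Hom C D} →
                (h ∘ g) ∘ f ≈ h ∘ (g ∘ f)
    identityˡ : ∀ {A B} {f : Hom A B} → id ∘ f ≈ f
    identityʳ : ∀ {A B} {f : Hom A B} → f ∘ id ≈ f
    ∘-resp-≈  : ∀ {A B C} {f h : Hom B C} {g i : Hom A B} →
                f ≈ h → g ≈ i → f ∘ g ≈ h ∘ i

record RawMonad {o ℓ e} (C : RawCategory o ℓ e) : Set (o ⊔ ℓ) where
  open RawCategory C
  field
    F₀ : Obj → Obj
    F₁ : ∀ {A B} → Hom A B → Hom (F₀ A) (F₀ B)
    η  : ∀ A → Hom A (F₀ A)
    μ  : ∀ A → Hom (F₀ (F₀ A)) (F₀ A)

record Monad {o ℓ e} (C : Category o ℓ e) : Set (o ⊔ ℓ ⊔ e) where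
  open Category C
  field
    rawMonad : RawMonad (Category.raw C)
  open RawMonad rawMonad public
  field
    F-resp-≈     : ∀ {A B} {f g : Hom A B} → f ≈ g → F₁ f ≈ F₁ g
    F-identity   : ∀ {A} → F₁ (id {A}) ≈ id
    F-homomorphism : ∀ {A B C} {f : Hom A B} {g : Hom B C} →
                     F₁ (g ∘ f) ≈ F₁ g ∘ F₁ f
    η-natural    : ∀ {A B} (f : Hom A B) → η B ∘ f ≈ F₁ f ∘ η A
    μ-natural    : ∀ {A B} (f : Hom A B) → μ B ∘ F₁ (F₁ f) ≈ F₁ f ∘ μ A
    μ-assoc      : ∀ A → μ A ∘ F₁ (μ A) ≈ μ A ∘ μ (F₀ A)
    μ-identityˡ  : ∀ A → μ A ∘ F₁ (η A) ≈ id
    μ-identityʳ  : ∀ A → μ A ∘ η (F₀ A) ≈ id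

record IsSelfDistributiveLaw {o ℓ e} (C : RawCategory o ℓ e) (T : RawMonad C)
       (l : ∀ A → RawCategory.Hom C (RawMonad.F₀ T (RawMonad.F₀ T A))
                                      (RawMonad.F₀ T (RawMonad.F₀ T A)))
       : Set (o ⊔ ℓ ⊔ e) where
  open RawCategory C
  open RawMonad T
  field
    natural : ∀ {A B} (f : Hom A B) → l B ∘ F₁ (F₁ f) ≈ F₁ (F₁ f) ∘ l A
    law-μT  : ∀ A → μ (F₀ A) ∘ (F₁ (l A) ∘ l (F₀ A)) ≈ l A ∘ F₁ (μ A)
    law-Tη  : ∀ A → l A ∘ F₁ (η A) ≈ η (F₀ A)
    law-Tμ  : ∀ A → F₁ (μ A) ∘ (l (F₀ A) ∘ F₁ (l A)) ≈ l A ∘ μ (F₀ A)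
    law-ηT  : ∀ A → l A ∘ η (F₀ A) ≈ F₁ (η A)
    yang-baxter : ∀ A → F₁ (l A) ∘ (l (F₀ A) ∘ F₁ (l A))
                        ≈ l (F₀ A) ∘ (F₁ (l A) ∘ l (F₀ A))

module _ {o ℓ e} (V : Category o ℓ e) (T : Monad V) where
  open Category V
  open Monad T

  Kleisli : RawCategory o ℓ e
  Kleisli = record
    { Obj = Obj
    ; Hom = λ A B → Hom A (F₀ B)
    ; _≈_ = _≈_
    ; id  = λ {A} → η A
    ; _∘_ = λ {A} {B} {C} g f → μ C ∘ (F₁ g ∘ f)
    }

  module _ (l : ∀ A → Hom (F₀ (F₀ A)) (F₀ (F₀ A))) where

    KleisliLifting : RawMonad Kleisli
    KleisliLifting = record
      { F₀ = F₀
      ; F₁ = λ {A} {B} f → l B ∘ F₁ f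
      ; η  = λ A → η (F₀ A) ∘ η A
      ; μ  = λ A → η (F₀ A) ∘ μ A
      }

    lT : ∀ A → RawCategory.Hom Kleisli (F₀ (F₀ A)) (F₀ (F₀ A))
    lT A = η (F₀ (F₀ A)) ∘ l A

{-# OPTIONS --safe #-}
module Submission where

open import Defs
open import Relation.Binary using (Setoid)
import Relation.Binary.Reasoning.Setoid as SetoidReasoning

-- Call a Kleisli morphism pure if it has the form η ∘ h. The unit, the
-- multiplication and l_T are all pure, pure is a functor V → V_T, and the
-- lifting sends pure h to pure (T h) because l ∘ Tη = ηT. So the four
-- distributive-law axioms and the Yang–Baxter equation for l_T are the
-- images under pure of those for l. Only naturality of l_T concerns
-- arbitrary Kleisli morphisms; there Yang–Baxter for l is what makes it hold.

module KleisliCalculus {o ℓ e} (V : Category o ℓ e) (T : Monad V) where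
  open Category V
  open Monad T
  open RawCategory (Kleisli V T) public using () renaming (_∘_ to _∘ₖ_)

  hom-setoid : ∀ A B → Setoid ℓ e
  hom-setoid A B = record { isEquivalence = equiv {A} {B} }

  module HomReasoning {A B} = SetoidReasoning (hom-setoid A B)
  module HomEquivalence {A B} = Setoid (hom-setoid A B)
  open HomReasoning
  open HomEquivalence using (refl; trans)

  pure : ∀ {A B} → Hom A B → Hom A (F₀ B)
  pure {B = B} h = η B ∘ h

  pure-resp-≈ : ∀ {A B} {f g : Hom A B} → f ≈ g → pure f ≈ pure g
  pure-resp-≈ = ∘-resp-≈ refl

  ∘ₖ-resp-≈ : ∀ {A B C} {f h : Hom B (F₀ C)} {g i : Hom A (F₀ B)} →
              f ≈ h → g ≈ i → f ∘ₖ g ≈ h ∘ₖ i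
  ∘ₖ-resp-≈ f≈h g≈i = ∘-resp-≈ refl (∘-resp-≈ (F-resp-≈ f≈h) g≈i)

  ∘ₖ-pureʳ : ∀ {A B C} (g : Hom B (F₀ C)) (f : Hom A B) → g ∘ₖ pure f ≈ g ∘ f
  ∘ₖ-pureʳ {C = C} g f = begin
    μ C ∘ (F₁ g ∘ (η _ ∘ f))  ≈⟨ ∘-resp-≈ refl assoc ⟨
    μ C ∘ ((F₁ g ∘ η _) ∘ f)  ≈⟨ ∘-resp-≈ refl (∘-resp-≈ (η-natural g) refl) ⟨
    μ C ∘ ((η _ ∘ g) ∘ f)     ≈⟨ ∘-resp-≈ refl assoc ⟩
    μ C ∘ (η _ ∘ (g ∘ f))     ≈⟨ assoc ⟨
    (μ C ∘ η _) ∘ (g ∘ f)     ≈⟨ ∘-resp-≈ (μ-identityʳ C) refl ⟩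
    id ∘ (g ∘ f)              ≈⟨ identityˡ ⟩
    g ∘ f                     ∎

  pure-∘ₖ : ∀ {A B C} (h : Hom B C) (f : Hom A (F₀ B)) → pure h ∘ₖ f ≈ F₁ h ∘ f
  pure-∘ₖ {C = C} h f = begin
    μ C ∘ (F₁ (η C ∘ h) ∘ f)       ≈⟨ ∘-resp-≈ refl (∘-resp-≈ F-homomorphism refl) ⟩
    μ C ∘ ((F₁ (η C) ∘ F₁ h) ∘ f)  ≈⟨ ∘-resp-≈ refl assoc ⟩
    μ C ∘ (F₁ (η C) ∘ (F₁ h ∘ f))  ≈⟨ assoc ⟨
    (μ C ∘ F₁ (η C)) ∘ (F₁ h ∘ f)  ≈⟨ ∘-resp-≈ (μ-identityˡ C) refl ⟩
    id ∘ (F₁ h ∘ f)                ≈⟨ identityˡ ⟩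
    F₁ h ∘ f                       ∎

  pure-homomorphism : ∀ {A B C} (g : Hom B C) (f : Hom A B) →
                      pure g ∘ₖ pure f ≈ pure (g ∘ f)
  pure-homomorphism g f = trans (∘ₖ-pureʳ (pure g) f) assoc

  pure-homomorphism₃ : ∀ {A B C D} (h : Hom C D) (g : Hom B C) (f : Hom A B) →
                       pure h ∘ₖ (pure g ∘ₖ pure f) ≈ pure (h ∘ (g ∘ f))
  pure-homomorphism₃ h g f =
    trans (∘ₖ-resp-≈ refl (pure-homomorphism g f)) (pure-homomorphism h (g ∘ f))

module KleisliLiftingCalculus {o ℓ e} (V : Category o ℓ e) (T : Monad V)
    (l : ∀ A → Category.Hom V (Monad.F₀ T (Monad.F₀ T A)) (Monad.F₀ T (Monad.F₀ T A)))
    (L : IsSelfDistributiveLaw (Category.raw V) (Monad.rawMonad T) l) where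
  open Category V
  open Monad T
  open IsSelfDistributiveLaw L
  open KleisliCalculus V T
  open HomReasoning
  open HomEquivalence using (refl; trans)
  open RawMonad (KleisliLifting V T l) using () renaming (F₁ to lift)

  lift-pure : ∀ {A B} (h : Hom A B) → lift (pure h) ≈ pure (F₁ h)
  lift-pure {B = B} h = begin
    l B ∘ F₁ (η _ ∘ h)        ≈⟨ ∘-resp-≈ refl F-homomorphism ⟩
    l B ∘ (F₁ (η _) ∘ F₁ h)   ≈⟨ assoc ⟨
    (l B ∘ F₁ (η _)) ∘ F₁ h   ≈⟨ ∘-resp-≈ (law-Tη B) refl ⟩
    η _ ∘ F₁ h                ∎

  lT-natural : ∀ {A B} (f : Hom A (F₀ B)) →
               pure (l B) ∘ₖ lift (lift f) ≈ lift (lift f) ∘ₖ pure (l A)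
  lT-natural {A} {B} f = begin
    pure (l B) ∘ₖ lift (lift f)                               ≈⟨ pure-∘ₖ (l B) _ ⟩
    F₁ (l B) ∘ (l _ ∘ F₁ (l B ∘ F₁ f))                        ≈⟨ ∘-resp-≈ refl (∘-resp-≈ refl F-homomorphism) ⟩
    F₁ (l B) ∘ (l _ ∘ (F₁ (l B) ∘ F₁ (F₁ f)))                 ≈⟨ ∘-resp-≈ refl assoc ⟨
    F₁ (l B) ∘ ((l _ ∘ F₁ (l B)) ∘ F₁ (F₁ f))                 ≈⟨ assoc ⟨
    (F₁ (l B) ∘ (l _ ∘ F₁ (l B))) ∘ F₁ (F₁ f)                 ≈⟨ ∘-resp-≈ (yang-baxter B) refl ⟩
    (l _ ∘ (F₁ (l B) ∘ l _)) ∘ F₁ (F₁ f)                      ≈⟨ trans assoc (∘-resp-≈ refl assoc) ⟩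
    l _ ∘ (F₁ (l B) ∘ (l _ ∘ F₁ (F₁ f)))                      ≈⟨ ∘-resp-≈ refl (∘-resp-≈ refl (natural f)) ⟩
    l _ ∘ (F₁ (l B) ∘ (F₁ (F₁ f) ∘ l A))                      ≈⟨ trans assoc (∘-resp-≈ refl assoc) ⟨
    (l _ ∘ (F₁ (l B) ∘ F₁ (F₁ f))) ∘ l A                      ≈⟨ ∘-resp-≈ (∘-resp-≈ refl F-homomorphism) refl ⟨
    lift (lift f) ∘ l A                                       ≈⟨ ∘ₖ-pureʳ _ (l A) ⟨
    lift (lift f) ∘ₖ pure (l A)                               ∎

  lT-isSelfDistributiveLaw : IsSelfDistributiveLaw (Kleisli V T) (KleisliLifting V T l) (lT V T l)
  lT-isSelfDistributiveLaw = record
    { natural = lT-natural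
    ; law-μT = λ A → begin
        pure (μ _) ∘ₖ (lift (pure (l A)) ∘ₖ pure (l _))   ≈⟨ ∘ₖ-resp-≈ refl (∘ₖ-resp-≈ (lift-pure (l A)) refl) ⟩
        pure (μ _) ∘ₖ (pure (F₁ (l A)) ∘ₖ pure (l _))     ≈⟨ pure-homomorphism₃ _ _ _ ⟩
        pure (μ _ ∘ (F₁ (l A) ∘ l _))                     ≈⟨ pure-resp-≈ (law-μT A) ⟩
        pure (l A ∘ F₁ (μ A))                             ≈⟨ pure-homomorphism _ _ ⟨
        pure (l A) ∘ₖ pure (F₁ (μ A))                     ≈⟨ ∘ₖ-resp-≈ refl (lift-pure (μ A)) ⟨
        pure (l A) ∘ₖ lift (pure (μ A))                   ∎
    ; law-Tη = λ A → begin
        pure (l A) ∘ₖ lift (pure (η A))                   ≈⟨ ∘ₖ-resp-≈ refl (lift-pure (η A)) ⟩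
        pure (l A) ∘ₖ pure (F₁ (η A))                     ≈⟨ pure-homomorphism _ _ ⟩
        pure (l A ∘ F₁ (η A))                             ≈⟨ pure-resp-≈ (law-Tη A) ⟩
        pure (η _)                                        ∎
    ; law-Tμ = λ A → begin
        lift (pure (μ A)) ∘ₖ (pure (l _) ∘ₖ lift (pure (l A)))   ≈⟨ ∘ₖ-resp-≈ (lift-pure (μ A)) (∘ₖ-resp-≈ refl (lift-pure (l A))) ⟩
        pure (F₁ (μ A)) ∘ₖ (pure (l _) ∘ₖ pure (F₁ (l A)))       ≈⟨ pure-homomorphism₃ _ _ _ ⟩
        pure (F₁ (μ A) ∘ (l _ ∘ F₁ (l A)))                       ≈⟨ pure-resp-≈ (law-Tμ A) ⟩
        pure (l A ∘ μ _)                                         ≈⟨ pure-homomorphism _ _ ⟨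
        pure (l A) ∘ₖ pure (μ _)                                 ∎
    ; law-ηT = λ A → begin
        pure (l A) ∘ₖ pure (η _)                          ≈⟨ pure-homomorphism _ _ ⟩
        pure (l A ∘ η _)                                  ≈⟨ pure-resp-≈ (law-ηT A) ⟩
        pure (F₁ (η A))                                   ≈⟨ lift-pure (η A) ⟨
        lift (pure (η A))                                 ∎
    ; yang-baxter = λ A → begin
        lift (pure (l A)) ∘ₖ (pure (l _) ∘ₖ lift (pure (l A)))   ≈⟨ ∘ₖ-resp-≈ (lift-pure (l A)) (∘ₖ-resp-≈ refl (lift-pure (l A))) ⟩
        pure (F₁ (l A)) ∘ₖ (pure (l _) ∘ₖ pure (F₁ (l A)))       ≈⟨ pure-homomorphism₃ _ _ _ ⟩
        pure (F₁ (l A) ∘ (l _ ∘ F₁ (l A)))                       ≈⟨ pure-resp-≈ (yang-baxter A) ⟩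
        pure (l _ ∘ (F₁ (l A) ∘ l _))                            ≈⟨ pure-homomorphism₃ _ _ _ ⟨
        pure (l _) ∘ₖ (pure (F₁ (l A)) ∘ₖ pure (l _))            ≈⟨ ∘ₖ-resp-≈ refl (∘ₖ-resp-≈ (lift-pure (l A)) refl) ⟨
        pure (l _) ∘ₖ (lift (pure (l A)) ∘ₖ pure (l _))          ∎
    }

lemma4p12 : ∀ {o ℓ e} (V : Category o ℓ e) (T : Monad V)
              (l : ∀ A → Category.Hom V (Monad.F₀ T (Monad.F₀ T A)) (Monad.F₀ T (Monad.F₀ T A))) →
              IsSelfDistributiveLaw (Category.raw V) (Monad.rawMonad T) l →
              IsSelfDistributiveLaw (Kleisli V T) (KleisliLifting V T l) (lT V T l)
lemma4p12 V T l L = KleisliLiftingCalculus.lT-isSelfDistributiveLaw V T l L
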